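{- Let $p,r$ be positive integers and $k$ a positive integer. Then the number $T_{p,r}(k)$ of distinct coral diagrams of type $(p,r)$ with precisely $k$ $p$-stars equals the Raney number $R_{p,r}(k)$: $$T_{p,r}(k) = R_{p,r}(k) = \binom{pk+r-1}{k-1}\frac{r}{k}.$$
   Context: The Raney numbers are $R_{p,r}(n) = \frac{r}{np+r}\binom{np+r}{n}$. A $p$-star is a rooted tree consisting of a single base vertex with $p$ terminal edges lying above it. A coral diagram of type $(p,r)$ is a planar rooted tree obtained as follows: start from a base vertex with $r+1$ terminal edges, ordered left to right; then repeatedly choose a terminal vertex that is not the endpoint of the leftmost edge adjacent to the base vertex, and attach a $p$-star there by identifying the star's base vertex with that terminal vertex. Equivalently, it is a plane (ordered) rooted tree in which the root has exactly $r+1$ ordered children, the leftmost child of the root is a leaf, and every other non-leaf, non-root vertex has exactly $p$ ordered children; the number of $p$-stars is the number of non-root, non-leaf vertices. Two coral diagrams are the same if they are isomorphic as plane rooted trees. $T_{p,r}(k)$ denotes the number of distinct coral diagrams of type $(p,r)$ with exactly $k$ $p$-stars. -}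

module Defs where

open import Data.Nat using (ℕ; zero; suc; _+_)
open import Data.List using (List; []; _∷_; length)
open import Data.List.Relation.Unary.All using (All)
open import Relation.Binary.PropositionalEquality using (_≡_)

-- Plane (ordered) rooted trees: a vertex with an ordered list of children.
-- Two plane rooted trees are isomorphic iff they are equal as values of this type.
data PlaneTree : Set where
  node : List PlaneTree → PlaneTree

leafT : PlaneTree
leafT = node []

data IsPStarTree (p : ℕ) : PlaneTree → Set where
  leaf : IsPStarTree p leafT
  star : ∀ {ts} → length ts ≡ p → All (IsPStarTree p) ts → IsPStarTree p (node ts)

data IsCoral (p r : ℕ) : PlaneTree → Set where
  coral : ∀ {ts} → length ts ≡ r → All (IsPStarTree p) ts → IsCoral p r (node (leafT ∷ ts))

mutual
  internalCount : PlaneTree → ℕ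
  internalCount (node []) = 0
  internalCount (node (t ∷ ts)) = suc (internalCountList (t ∷ ts))

  internalCountList : List PlaneTree → ℕ
  internalCountList [] = 0
  internalCountList (t ∷ ts) = internalCount t + internalCountList ts

-- number of p-stars = number of non-root, non-leaf vertices
stars : PlaneTree → ℕ
stars (node ts) = internalCountList ts

-- Deleting the root of a coral diagram together with its leftmost leaf leaves an ordered
-- forest of r trees in which every vertex is a leaf or a p-star.  Looking at the first tree
-- (a leaf, or a p-star whose p subtrees can be merged into the rest of the forest) shows
-- that these forests are counted by R(0, r) = 1, R(k+1, 0) = 0 and
-- R(k+1, r+1) = R(k+1, r) + R(k, p+r).  The Raney number r/(pk+r)·C(pk+r, k) satisfies the
-- same recurrence, by Pascal's rule and the absorption identity (n+1)·C(n,k) = (k+1)·C(n+1,k+1).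

module Submission where

open import Defs
open import Data.Empty using (⊥; ⊥-elim)
open import Data.Fin using (Fin)
open import Data.Fin.Properties using (0↔⊥; 1↔⊤; +↔⊎)
open import Data.List using (List; []; _∷_; length; _++_; take; drop)
open import Data.List.Properties using (length-++; length-take; length-drop; take++drop≡id)
open import Data.List.Relation.Unary.All using (All; []; _∷_)
open import Data.List.Relation.Unary.All.Properties using (++⁺; take⁺; drop⁺)
open import Data.Nat
open import Data.Nat.Combinatorics using (_C_; nC1≡n; nCk+nC[k+1]≡[n+1]C[k+1])
open import Data.Nat.Properties
open import Data.Nat.Tactic.RingSolver using (solve-∀)
open import Data.Product using (Σ; ∃-syntax; _×_; _,_; proj₁)
open import Data.Sum using (_⊎_; inj₁; inj₂)
open import Data.Sum.Function.Propositional using (_⊎-↔_)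
open import Data.Unit using (⊤; tt)
open import Function.Bundles using (_↔_; mk↔ₛ′)
open import Function.Properties.Inverse using (↔-trans; ↔-sym)
open import Relation.Binary.PropositionalEquality
open ≡-Reasoning

[1+n]*nCk≡[1+k]*[1+n]C[1+k] : ∀ n k → suc n * (n C k) ≡ suc k * (suc n C suc k)
[1+n]*nCk≡[1+k]*[1+n]C[1+k] zero    zero    = refl
[1+n]*nCk≡[1+k]*[1+n]C[1+k] zero    (suc k) = sym (*-zeroʳ (2 + k))
[1+n]*nCk≡[1+k]*[1+n]C[1+k] (suc n) zero    = begin
  (2 + n) * 1      ≡⟨ *-identityʳ (2 + n) ⟩
  2 + n            ≡⟨ nC1≡n (2 + n) ⟨
  (2 + n) C 1      ≡⟨ +-identityʳ _ ⟨
  1 * ((2 + n) C 1) ∎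
[1+n]*nCk≡[1+k]*[1+n]C[1+k] (suc n) (suc k) = begin
  (2 + n) * (suc n C suc k)             ≡⟨ cong ((2 + n) *_) (pascal n k) ⟨
  (2 + n) * (a + b)                     ≡⟨ expand n a b ⟩
  (suc n * a + suc n * b) + (a + b)     ≡⟨ cong₂ (λ x y → x + y + (a + b))
                                            ([1+n]*nCk≡[1+k]*[1+n]C[1+k] n k)
                                            ([1+n]*nCk≡[1+k]*[1+n]C[1+k] n (suc k)) ⟩
  (suc k * c + (2 + k) * d) + (a + b)   ≡⟨ cong (suc k * c + (2 + k) * d +_) (pascal n k) ⟩
  (suc k * c + (2 + k) * d) + c         ≡⟨ collect k c d ⟩
  (2 + k) * (c + d)                     ≡⟨ cong ((2 + k) *_) (pascal (suc n) (suc k)) ⟩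
  (2 + k) * ((2 + n) C (2 + k))         ∎
  where
  pascal = nCk+nC[k+1]≡[n+1]C[k+1]
  a = n C k
  b = n C suc k
  c = suc n C suc k
  d = suc n C suc (suc k)
  expand : ∀ n a b → (2 + n) * (a + b) ≡ (suc n * a + suc n * b) + (a + b)
  expand = solve-∀
  collect : ∀ k c d → (suc k * c + (2 + k) * d) + c ≡ (2 + k) * (c + d)
  collect = solve-∀

[1+n]*nC[1+k]≡j*[1+n]C[1+k] : ∀ {n} k j → k + j ≡ n → suc n * (n C suc k) ≡ j * (suc n C suc k)
[1+n]*nC[1+k]≡j*[1+n]C[1+k] {n} k j refl = +-cancelˡ-≡ (suc k * X) _ _ (begin
  suc k * X + suc n * (n C suc k)       ≡⟨ cong (_+ suc n * (n C suc k)) ([1+n]*nCk≡[1+k]*[1+n]C[1+k] n k) ⟨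
  suc n * (n C k) + suc n * (n C suc k) ≡⟨ *-distribˡ-+ (suc n) (n C k) (n C suc k) ⟨
  suc n * (n C k + n C suc k)           ≡⟨ cong (suc n *_) (nCk+nC[k+1]≡[n+1]C[k+1] n k) ⟩
  suc n * X                             ≡⟨ *-distribʳ-+ X (suc k) j ⟩
  suc k * X + j * X                     ∎)
  where X = suc n C suc k

module Raney (q : ℕ) where

  p : ℕ
  p = suc q

  raney : ℕ → ℕ → ℕ
  raney zero    r       = 1
  raney (suc k) zero    = 0
  raney (suc k) (suc r) = raney (suc k) r + raney k (p + r)

  raney-step : ∀ k r A B →
    A * (p * suc k + r) ≡ r * ((p * suc k + r) C suc k) →
    B * (p * suc k + r) ≡ (p + r) * ((p * suc k + r) C k) →
    (A + B) * suc (p * suc k + r) ≡ suc r * (suc (p * suc k + r) C suc k)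
  raney-step k r A B A*n≡ B*n≡ = *-cancelʳ-≡ _ _ n (begin
    (A + B) * suc n * n                        ≡⟨ factor A B n ⟩
    suc n * (A * n + B * n)                    ≡⟨ cong₂ (λ x y → suc n * (x + y)) A*n≡ B*n≡ ⟩
    suc n * (r * (n C suc k) + (p + r) * (n C k))
                                               ≡⟨ distribute n r (p + r) (n C suc k) (n C k) ⟩
    r * (suc n * (n C suc k)) + (p + r) * (suc n * (n C k))
                                               ≡⟨ cong₂ (λ x y → r * x + (p + r) * y)
                                                   ([1+n]*nC[1+k]≡j*[1+n]C[1+k] k j (k+j≡n q k r))
                                                   ([1+n]*nCk≡[1+k]*[1+n]C[1+k] n k) ⟩
    r * (j * X) + (p + r) * (suc k * X)        ≡⟨ collect q k r X ⟩
    suc r * X * n                              ∎)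
    where
    n = p * suc k + r
    j = suc (q * suc k + r)
    X = suc n C suc k
    factor : ∀ a b n → (a + b) * suc n * n ≡ suc n * (a * n + b * n)
    factor = solve-∀
    distribute : ∀ n a b x y → suc n * (a * x + b * y) ≡ a * (suc n * x) + b * (suc n * y)
    distribute = solve-∀
    k+j≡n : ∀ q k r → k + suc (q * suc k + r) ≡ suc q * suc k + r
    k+j≡n = solve-∀
    collect : ∀ q k r x → r * (suc (q * suc k + r) * x) + (suc q + r) * (suc k * x)
                          ≡ suc r * x * (suc q * suc k + r)
    collect = solve-∀

  raney-closed : ∀ k r → raney k r * (p * k + r) ≡ r * ((p * k + r) C k)
  raney-closed zero r = begin
    1 * (p * 0 + r) ≡⟨ cong (λ m → 1 * (m + r)) (*-zeroʳ p) ⟩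
    1 * r           ≡⟨ *-comm 1 r ⟩
    r * 1           ∎
  raney-closed (suc k) zero    = refl
  raney-closed (suc k) (suc r) =
    subst (λ m → raney (suc k) (suc r) * m ≡ suc r * (m C suc k)) (sym (+-suc (p * suc k) r))
      (raney-step k r (raney (suc k) r) (raney k (p + r)) (raney-closed (suc k) r)
        (subst (λ m → raney k (p + r) * m ≡ (p + r) * (m C k)) (shift q k r) (raney-closed k (p + r))))
    where
    shift : ∀ q k r → suc q * k + (suc q + r) ≡ suc q * suc k + r
    shift = solve-∀

  raney-closed′ : ∀ k r → raney (suc k) r * suc k ≡ r * ((p * suc k + r ∸ 1) C k)
  -- Since p = suc q, n is a successor and suc (n ∸ 1) reduces to n.
  raney-closed′ k r = *-cancelʳ-≡ _ _ n (begin
    raney (suc k) r * suc k * n     ≡⟨ swap₁ (raney (suc k) r) (suc k) n ⟩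
    raney (suc k) r * n * suc k     ≡⟨ cong (_* suc k) (raney-closed (suc k) r) ⟩
    r * (n C suc k) * suc k         ≡⟨ swap₂ r (n C suc k) (suc k) ⟩
    r * (suc k * (n C suc k))       ≡⟨ cong (r *_) ([1+n]*nCk≡[1+k]*[1+n]C[1+k] (n ∸ 1) k) ⟨
    r * (n * ((n ∸ 1) C k))         ≡⟨ swap₃ r n ((n ∸ 1) C k) ⟩
    r * ((n ∸ 1) C k) * n           ∎)
    where
    n = p * suc k + r
    swap₁ : ∀ a b c → a * b * c ≡ a * c * b
    swap₁ = solve-∀
    swap₂ : ∀ a b c → a * b * c ≡ a * (c * b)
    swap₂ = solve-∀
    swap₃ : ∀ a b c → a * (b * c) ≡ a * c * b
    swap₃ = solve-∀

module _ {a} {A : Set a} where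

  length-take-+ : ∀ m {n} (xs : List A) → length xs ≡ m + n → length (take m xs) ≡ m
  length-take-+ m {n} xs eq =
    trans (length-take m xs) (trans (cong (m ⊓_) eq) (m≤n⇒m⊓n≡m (m≤m+n m n)))

  length-drop-+ : ∀ m {n} (xs : List A) → length xs ≡ m + n → length (drop m xs) ≡ n
  length-drop-+ m {n} xs eq = trans (length-drop m xs) (trans (cong (_∸ m) eq) (m+n∸m≡n m n))

  take-++-length : ∀ {n} (xs ys : List A) → length xs ≡ n → take n (xs ++ ys) ≡ xs
  take-++-length []       ys refl = refl
  take-++-length (x ∷ xs) ys refl = cong (x ∷_) (take-++-length xs ys refl)

  drop-++-length : ∀ {n} (xs ys : List A) → length xs ≡ n → drop n (xs ++ ys) ≡ ys
  drop-++-length []       ys refl = refl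
  drop-++-length (x ∷ xs) ys refl = drop-++-length xs ys refl

internalCountList-++ : ∀ ts us →
  internalCountList (ts ++ us) ≡ internalCountList ts + internalCountList us
internalCountList-++ []       us = refl
internalCountList-++ (t ∷ ts) us =
  trans (cong (internalCount t +_) (internalCountList-++ ts us)) (sym (+-assoc (internalCount t) _ _))

internalCount-nonLeaf : ∀ {n ts} → length ts ≡ suc n → internalCount (node ts) ≡ suc (internalCountList ts)
internalCount-nonLeaf {ts = _ ∷ _} _ = refl

-- For p = 0 this fails: a leaf is then also a 0-star.
mutual
  isPStarTree-irrelevant : ∀ {q t} (x y : IsPStarTree (suc q) t) → x ≡ y
  isPStarTree-irrelevant leaf          leaf            = refl
  isPStarTree-irrelevant leaf          (star () _)
  isPStarTree-irrelevant (star () _)   leaf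
  isPStarTree-irrelevant (star eq xs)  (star eq′ ys)   =
    cong₂ star (≡-irrelevant eq eq′) (allPStarTree-irrelevant xs ys)

  allPStarTree-irrelevant : ∀ {q ts} (xs ys : All (IsPStarTree (suc q)) ts) → xs ≡ ys
  allPStarTree-irrelevant []       []       = refl
  allPStarTree-irrelevant (x ∷ xs) (y ∷ ys) =
    cong₂ _∷_ (isPStarTree-irrelevant x y) (allPStarTree-irrelevant xs ys)

module Forests (q : ℕ) where

  open Raney q

  Forest : ℕ → ℕ → Set
  Forest r k = Σ (List PlaneTree) λ ts →
    length ts ≡ r × All (IsPStarTree p) ts × internalCountList ts ≡ k

  forest-≡ : ∀ {r k} {f g : Forest r k} → proj₁ f ≡ proj₁ g → f ≡ g
  forest-≡ {f = ts , l , a , c} {.ts , l′ , a′ , c′} refl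
    rewrite ≡-irrelevant l l′ | allPStarTree-irrelevant a a′ | ≡-irrelevant c c′ = refl

  forest-0-0 : Forest 0 0 ↔ ⊤
  forest-0-0 = mk↔ₛ′ (λ _ → tt) (λ _ → [] , refl , [] , refl) (λ _ → refl) from∘to
    where
    from∘to : ∀ f → ([] , refl , [] , refl) ≡ f
    from∘to ([] , _ , _ , _) = forest-≡ refl

  forest-0-suc : ∀ k → Forest 0 (suc k) ↔ ⊥
  forest-0-suc k = mk↔ₛ′ empty (λ ()) (λ ()) (λ f → ⊥-elim (empty f))
    where
    empty : Forest 0 (suc k) → ⊥
    empty ([] , _ , _ , ())

  forest-suc-0 : ∀ r → Forest (suc r) 0 ↔ Forest r 0
  forest-suc-0 r = mk↔ₛ′ to from (λ _ → forest-≡ refl) from∘to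
    where
    to : Forest (suc r) 0 → Forest r 0
    to (_ ∷ ts , l , leaf ∷ a , c) = ts , suc-injective l , a , c
    to (node (_ ∷ _) ∷ _ , _ , star _ _ ∷ _ , ())
    from : Forest r 0 → Forest (suc r) 0
    from (ts , l , a , c) = leafT ∷ ts , cong suc l , leaf ∷ a , c
    from∘to : ∀ f → from (to f) ≡ f
    from∘to (_ ∷ _ , _ , leaf ∷ _ , _) = forest-≡ refl
    from∘to (node (_ ∷ _) ∷ _ , _ , star _ _ ∷ _ , ())

  forest-suc-suc : ∀ r k → Forest (suc r) (suc k) ↔ (Forest r (suc k) ⊎ Forest (p + r) k)
  forest-suc-suc r k = mk↔ₛ′ to from to∘from from∘to
    where
    to : Forest (suc r) (suc k) → Forest r (suc k) ⊎ Forest (p + r) k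
    to (_ ∷ ts , l , leaf ∷ a , c) = inj₁ (ts , suc-injective l , a , c)
    to (node cs ∷ ts , l , star lcs acs ∷ a , c) = inj₂
      ( cs ++ ts
      , trans (length-++ cs) (cong₂ _+_ lcs (suc-injective l))
      , ++⁺ acs a
      , trans (internalCountList-++ cs ts)
          (suc-injective (trans (cong (_+ internalCountList ts) (sym (internalCount-nonLeaf lcs))) c)))
    from : Forest r (suc k) ⊎ Forest (p + r) k → Forest (suc r) (suc k)
    from (inj₁ (ts , l , a , c)) = leafT ∷ ts , cong suc l , leaf ∷ a , c
    from (inj₂ (us , l , a , c)) =
      ( node (take p us) ∷ drop p us
      , cong suc (length-drop-+ p us l)
      , star (length-take-+ p us l) (take⁺ p a) ∷ drop⁺ p a
      , trans (cong (_+ internalCountList (drop p us)) (internalCount-nonLeaf (length-take-+ p us l)))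
          (cong suc (trans (sym (internalCountList-++ (take p us) (drop p us)))
                           (trans (cong internalCountList (take++drop≡id p us)) c))))
    to∘from : ∀ f → to (from f) ≡ f
    to∘from (inj₁ _)            = cong inj₁ (forest-≡ refl)
    to∘from (inj₂ (us , _ , _)) = cong inj₂ (forest-≡ (take++drop≡id p us))
    from∘to : ∀ f → from (to f) ≡ f
    from∘to (_ ∷ _ , _ , leaf ∷ _ , _) = forest-≡ refl
    from∘to (node cs ∷ ts , _ , star lcs _ ∷ _ , _) =
      forest-≡ (cong₂ (λ xs ys → node xs ∷ ys) (take-++-length cs ts lcs) (drop-++-length cs ts lcs))

  Fin-raney↔Forest : ∀ k r → Fin (raney k r) ↔ Forest r k
  Fin-raney↔Forest zero    zero    = ↔-trans 1↔⊤ (↔-sym forest-0-0)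
  Fin-raney↔Forest zero    (suc r) = ↔-trans (Fin-raney↔Forest zero r) (↔-sym (forest-suc-0 r))
  Fin-raney↔Forest (suc k) zero    = ↔-trans 0↔⊥ (↔-sym (forest-0-suc k))
  Fin-raney↔Forest (suc k) (suc r) =
    ↔-trans +↔⊎ (↔-trans (Fin-raney↔Forest (suc k) r ⊎-↔ Fin-raney↔Forest k (p + r))
                         (↔-sym (forest-suc-suc r k)))

  Forest↔Coral : ∀ r k → Forest r k ↔ Σ PlaneTree (λ t → IsCoral p r t × stars t ≡ k)
  Forest↔Coral r k = mk↔ₛ′ to from to∘from (λ _ → refl)
    where
    to : Forest r k → Σ PlaneTree (λ t → IsCoral p r t × stars t ≡ k)
    to (ts , l , a , c) = node (leafT ∷ ts) , coral l a , c
    from : Σ PlaneTree (λ t → IsCoral p r t × stars t ≡ k) → Forest r k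
    from (node (_ ∷ ts) , coral l a , c) = ts , l , a , c
    to∘from : ∀ t → to (from t) ≡ t
    to∘from (node (_ ∷ _) , coral _ _ , _) = refl

theorem2p5 : (p r k : ℕ) → .{{NonZero p}} → .{{NonZero r}} → .{{NonZero k}} →
    ∃[ N ] ((Fin N ↔ Σ PlaneTree (λ t → IsCoral p r t × stars t ≡ k))
    × (N * (p * k + r) ≡ r * ((p * k + r) C k))
    × (N * k ≡ r * ((p * k + r ∸ 1) C (k ∸ 1))))
theorem2p5 (suc q) r (suc k) =
  raney (suc k) r ,
  ↔-trans (Fin-raney↔Forest (suc k) r) (Forest↔Coral r (suc k)) ,
  raney-closed (suc k) r ,
  raney-closed′ k r
  where
  open Raney q
  open Forests q
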